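{- Let $p$ be a prime, $d\ge0$, $h\ge1$, $\overline x$ a tuple of variables and $\mathcal F\subseteq\mathbb F_p[\overline x]$ a finite set with $Var(\mathcal F)=\overline x$. Let $\Omega$ be a finite nonempty set of $\mathbb F_p$-linear maps from $\mathbb F_p[\overline x]_{\le d}$ to $\mathbb F_p$. Let $\mathcal E$ be a set of extension polynomials of accuracy $h$ stratified into levels (relative to $\mathcal F$), all of degree at most $d$. Then there is an assignment $\overline r:=\overline b$ of values from $\mathbb F_p$ to all extension variables of $\mathcal E$ such that for all $\omega\in\Omega$ except at most a fraction $|\mathcal E|e^{ -h/p}$ of them, every extension polynomial in $\mathcal E$ has a factor polynomial $g'(\overline x,\overline r)$ with $\omega(g'(\overline x,\overline b))=0$.
   Context: $\mathbb F_p[\overline x]_{\le d}$ is the space of polynomials of degree at most $d$ in $\overline x$. Extension polynomials of accuracy $h$ for polynomials $\overline g=g_1,\dots,g_m$: $E_{i,\overline g}:=g_i\prod_{u\le h}(1-\sum_{j\le m}r_{uj}g_j)$, $i\le m$, with new extension variables $r_{uj}$ common to all $i$ (companions). Its factor polynomials are $g_i$ and $1-\sum_{j\le m}r_{uj}g_j$, $u\le h$. A set $\mathcal E$ is stratified into $\ell$ levels if $\mathcal E=\mathcal E_1\cup\dots\cup\mathcal E_\ell$ (partition) with: companions in the same level; for $E_{i,\overline g}\in\mathcal E_1$ the variables of the $g_j$ are among $Var(\mathcal F)$ and its extension variables occur neither in $Var(\mathcal F)$ nor in other polynomials of $\mathcal E_1$ except companions; for $E_{i,\overline g}\in\mathcal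 E_{t+1}$ ($1\le t<\ell$) the variables of the $g_j$ are among the variables of $\mathcal F\cup\bigcup_{s\le t}\mathcal E_s$ (including extension variables) and its extension variables occur neither among these nor in other polynomials of $\mathcal E_{t+1}$ except companions. After substituting $\overline b$ for all extension variables, each factor polynomial becomes a polynomial $g'(\overline x,\overline b)$ in $\overline x$ only, of degree at most $d$. -}

module Defs where

open import Data.Nat as ℕ using (ℕ; zero; suc; _<_; _∸_; _^_; _!)
open import Data.Nat.Properties using (_!≢0)
open import Data.Nat.DivMod using (_/_)
open import Data.Integer as ℤ using (ℤ; +_)
open import Data.Integer.Divisibility using () renaming (_∣_ to _∣ℤ_)
open import Data.Fin as Fin using (Fin; toℕ)
open import Data.Vec as Vec using (Vec)
open import Data.Vec.Properties using (≡-dec)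
open import Data.List as List using (List; []; _∷_; _++_; length; lookup; allFin; concatMap)
open import Data.Product using (Σ; _×_; _,_)
open import Data.Nat.ListAction using () renaming (sum to lsum)
open import Data.Sum using (_⊎_; [_,_])
open import Data.Unit using (⊤; tt)
open import Relation.Nullary using (yes; no)

-- Polynomials with integer coefficients (read modulo a prime p, i.e. as
-- polynomials over F_p), given as formal expressions over a variable type V.

data Expr (V : Set) : Set where
  var  : V → Expr V
  con  : ℤ → Expr V
  _⊕_  : Expr V → Expr V → Expr V
  _⊗_  : Expr V → Expr V → Expr V
  ⊖_   : Expr V → Expr V

bind : {V W : Set} → (V → Expr W) → Expr V → Expr W
bind σ (var v)   = σ v
bind σ (con c)   = con c
bind σ (a ⊕ b)   = bind σ a ⊕ bind σ b
bind σ (a ⊗ b)   = bind σ a ⊗ bind σ b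
bind σ (⊖ a)     = ⊖ bind σ a

bigSum : {V : Set} (m : ℕ) → (Fin m → Expr V) → Expr V
bigSum m f = List.foldr (λ j acc → f j ⊕ acc) (con (+ 0)) (allFin m)

Monomial : ℕ → Set
Monomial n = Vec ℕ n

unitMon : {n : ℕ} → Fin n → Monomial n
unitMon i = Vec.tabulate (λ j → eq i j)
  where
  eq : {n : ℕ} → Fin n → Fin n → ℕ
  eq i j with i Fin.≟ j
  ... | yes _ = 1
  ... | no  _ = 0

totalDeg : {n : ℕ} → Monomial n → ℕ
totalDeg = Vec.sum

NF : ℕ → Set
NF n = List (ℤ × Monomial n)

nf : {n : ℕ} → Expr (Fin n) → NF n
nf (var i) = (+ 1 , unitMon i) ∷ []
nf {n} (con c) = (c , Vec.replicate n 0) ∷ []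
nf (a ⊕ b) = nf a ++ nf b
nf (a ⊗ b) = concatMap (λ { (c , m) → List.map (λ { (c' , m') → (c ℤ.* c' , Vec.zipWith ℕ._+_ m m') }) (nf b) }) (nf a)
nf (⊖ a) = List.map (λ { (c , m) → (ℤ.- c , m) }) (nf a)

coeff : {n : ℕ} → Expr (Fin n) → Monomial n → ℤ
coeff e m = List.foldr step (+ 0) (nf e)
  where
  step : _ → ℤ → ℤ
  step (c , m') acc with ≡-dec ℕ._≟_ m' m
  ... | yes _ = c ℤ.+ acc
  ... | no  _ = acc

DegLe : {n : ℕ} (p d : ℕ) → Expr (Fin n) → Set
DegLe p d e = ∀ m → d < totalDeg m → (+ p) ∣ℤ coeff e m

-- F_p-linear maps  F_p[x̄]_{≤d} → F_p, given by their values on the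
-- monomial basis (values on monomials of degree > d are irrelevant).

LinMap : ℕ → ℕ → Set
LinMap p n = Monomial n → Fin p

applyLin : {p n : ℕ} → LinMap p n → Expr (Fin n) → ℤ
applyLin ω e = List.foldr (λ { (c , m) acc → c ℤ.* (+ toℕ (ω m)) ℤ.+ acc }) (+ 0) (nf e)

Vanishes : {p n : ℕ} → LinMap p n → Expr (Fin n) → Set
Vanishes {p} ω e = (+ p) ∣ℤ applyLin ω e

-- A group consists of polynomials g_0,…,g_{m-1}; it yields the m companion
-- extension polynomials E_{i,ḡ} = g_i ∏_{u<h} (1 - Σ_j r_{uj} g_j) with
-- fresh extension variables r_{uj}, u < h, j < m.

record Group (V : Set) : Set where
  constructor group
  field
    m : ℕ
    g : Fin m → Expr V

-- the (fresh) extension variables introduced by one level (a list of groups):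
-- (group index k, u < h, j < m_k)
LVar : {V : Set} → ℕ → List (Group V) → Set
LVar h L = Σ (Fin (length L)) λ k → Fin h × Fin (Group.m (lookup L k))

-- Strat h V: a stratification into levels, where the g's of the first level
-- use only the variables V, and those of each next level use V together with
-- the extension variables of all earlier levels. Freshness of extension
-- variables is built into the construction.
data Strat (h : ℕ) : Set → Set₁ where
  done  : {V : Set} → Strat h V
  level : {V : Set} (L : List (Group V)) → Strat h (V ⊎ LVar h L) → Strat h V

count : {h : ℕ} {V : Set} → Strat h V → ℕ
count done        = 0
count (level L S) = lsum (List.map Group.m L) ℕ.+ count S

Assign : {h : ℕ} {V : Set} (p : ℕ) → Strat h V → Set
Assign p done        = ⊤
Assign {h} p (level L S) = (LVar h L → Fin p) × Assign p S

levelFactors : {h p : ℕ} {V X : Set} (L : List (Group V)) → (V → Expr X) →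
               (LVar h L → Fin p) → List (List (Expr X))
levelFactors {h} {p} {V} {X} L σ b = concatMap perGroup (allFin (length L))
  where
  perGroup : Fin (length L) → List (List (Expr X))
  perGroup k = List.map (λ i → bind σ (g i) ∷ List.map fac (allFin h)) (allFin m)
    where
    open Group (lookup L k)
    fac : Fin h → Expr X
    fac u = con (+ 1) ⊕ (⊖ bigSum m (λ j → con (+ toℕ (b (k , u , j))) ⊗ bind σ (g j)))

-- for every extension polynomial in ℰ, its list of factor polynomials g'(x̄, b̄)
allFactors : {h p : ℕ} {V X : Set} (S : Strat h V) → (V → Expr X) → Assign p S →
             List (List (Expr X))
allFactors done σ _ = []
allFactors {p = p} (level L S) σ (b , bs) =
  levelFactors L σ b ++ allFactors S [ σ , (λ v → con (+ toℕ (b v))) ] bs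

-- e^{h/p} via its partial sums: S_N = Σ_{j ≤ N} (h/p)^j / j!.
-- expNum h p N = p^N · N! · S_N  (a natural number).

expNum : ℕ → ℕ → ℕ → ℕ
expNum h p N = lsum (List.map term (List.upTo (suc N)))
  where
  term : ℕ → ℕ
  term j = h ^ j ℕ.* p ^ (N ∸ j) ℕ.* ((N !) / (j !)) {{j !≢0}}

{-# OPTIONS --safe #-}
module Submission where

-- Fix one group g_1,…,g_m and a map ω. If ω(g_j) ≠ 0 for some j, then
-- ω(1 − Σ_j r_j g_j) = ω(1) − Σ_j r_j ω(g_j) vanishes for at least a 1/p fraction of
-- the rows r ∈ F_p^m. By averaging, some row then serves a 1/p fraction of any set of
-- maps, so choosing the h rows of the group greedily leaves at most a fraction
-- (1 − 1/p)^h of the maps without a vanishing factor. The levels are treated one after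
-- the other, substituting the values already chosen into the later groups, and a union
-- bound over all extension polynomials gives the fraction |ℰ|(1 − 1/p)^h. Finally
-- (1 − 1/p)^h ≤ e^(−h/p), used in the form (1 − 1/p)^h Σ_{j≤N} (h/p)^j / j! ≤ 1,
-- holds because h^j / j! ≤ C(h+j−1, j) and Σ_j C(h+j−1, j) x^j = (1 − x)^(−h).

module FiniteSums where

  open import Data.Bool using (Bool; true; false; _∧_; _∨_; not)
  open import Data.Bool.Properties using (∧-identityʳ; ∨-conicalˡ; ∨-conicalʳ)
  open import Data.Fin using (Fin; zero; suc)
  open import Data.Nat
  open import Data.Nat.Properties
  open import Data.Product using (Σ-syntax; ∃-syntax; _,_; proj₁; proj₂)
  open import Data.Vec.Functional using (_∷_)
  open import Function using (_∘_)
  open import Relation.Binary.PropositionalEquality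
  open import Relation.Nullary using (yes; no)
  open import Algebra.Properties.CommutativeSemigroup *-commutativeSemigroup
    using (x∙yz≈y∙xz; xy∙z≈y∙xz)
  open import Algebra.Properties.Semiring.Sum +-*-semiring
    using (sum; sum-syntax; sum-cong-≗; sum-replicate-zero; ∑-distrib-+; ∑-comm; *-distribˡ-sum)

  ∑-const : ∀ n c → ∑[ i < n ] c ≡ n * c
  ∑-const zero    c = refl
  ∑-const (suc n) c = cong (c +_) (∑-const n c)

  ∑-mono-≤ : ∀ {n} {f g : Fin n → ℕ} → (∀ i → f i ≤ g i) → sum f ≤ sum g
  ∑-mono-≤ {zero}  f≤g = z≤n
  ∑-mono-≤ {suc n} f≤g = +-mono-≤ (f≤g zero) (∑-mono-≤ (f≤g ∘ suc))

  term≤∑ : ∀ {n} (f : Fin n → ℕ) i → f i ≤ sum f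
  term≤∑ f zero    = m≤m+n (f zero) _
  term≤∑ f (suc i) = ≤-trans (term≤∑ (f ∘ suc) i) (m≤n+m _ (f zero))

  argmax : ∀ {n} (f : Fin (suc n) → ℕ) → ∃[ i ] (∀ j → f j ≤ f i)
  argmax {zero}  f = zero , λ { zero → ≤-refl }
  argmax {suc n} f with argmax (f ∘ suc)
  ... | i , max with f zero ≤? f (suc i)
  ...   | yes f₀≤ = suc i , λ { zero → f₀≤ ; (suc j) → max j }
  ...   | no  f₀≰ = zero  , λ { zero → ≤-refl ; (suc j) → ≤-trans (max j) (<⇒≤ (≰⇒> f₀≰)) }

  𝟙 : Bool → ℕ
  𝟙 true  = 1
  𝟙 false = 0

  module _ {k : ℕ} where

    size : (Fin k → Bool) → ℕ
    size R = ∑[ i < k ] 𝟙 (R i)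

    size-full : size (λ _ → true) ≡ k
    size-full = trans (∑-const k 1) (*-identityʳ k)

    size-empty : size (λ _ → false) ≡ 0
    size-empty = sum-replicate-zero k

    size-split : ∀ (R C : Fin k → Bool) → size R ≡ size (λ i → R i ∧ C i) + size (λ i → R i ∧ not (C i))
    size-split R C = trans (sum-cong-≗ λ i → split (R i) (C i)) (∑-distrib-+ {k} _ _)
      where
      split : ∀ r c → 𝟙 r ≡ 𝟙 (r ∧ c) + 𝟙 (r ∧ not c)
      split false c     = refl
      split true  true  = refl
      split true  false = refl

    size-∪ : ∀ (R S : Fin k → Bool) → size (λ i → R i ∨ S i) ≤ size R + size S
    size-∪ R S = ≤-trans (∑-mono-≤ λ i → 𝟙-∨ (R i) (S i)) (≤-reflexive (∑-distrib-+ {k} _ _))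
      where
      𝟙-∨ : ∀ r s → 𝟙 (r ∨ s) ≤ 𝟙 r + 𝟙 s
      𝟙-∨ true  s = s≤s z≤n
      𝟙-∨ false s = ≤-refl

  ⋃ : ∀ {n k} → (Fin n → Fin k → Bool) → Fin k → Bool
  ⋃ {zero}  S i = false
  ⋃ {suc n} S i = S zero i ∨ ⋃ (S ∘ suc) i

  size-⋃ : ∀ {n k} (S : Fin n → Fin k → Bool) → size (⋃ S) ≤ ∑[ u < n ] size (S u)
  size-⋃ {zero}  {k} S = ≤-reflexive (size-empty {k})
  size-⋃ {suc n}     S = ≤-trans (size-∪ (S zero) (⋃ (S ∘ suc))) (+-monoʳ-≤ (size (S zero)) (size-⋃ (S ∘ suc)))

  ⋃-true : ∀ {n k} (S : Fin n → Fin k → Bool) i → ⋃ S i ≡ true → ∃[ u ] S u i ≡ true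
  ⋃-true {suc n} S i eq with S zero i in S₀
  ... | true  = zero , S₀
  ... | false = let u , Su = ⋃-true (S ∘ suc) i eq in suc u , Su

  ⋃-false : ∀ {n k} (S : Fin n → Fin k → Bool) i → ⋃ S i ≡ false → ∀ u → S u i ≡ false
  ⋃-false S i eq zero    = ∨-conicalˡ _ _ eq
  ⋃-false S i eq (suc u) = ⋃-false (S ∘ suc) i (∨-conicalʳ _ _ eq) u

  residual-shrinks : ∀ {k} q (R C : Fin k → Bool) → size R ≤ suc q * size (λ i → R i ∧ C i) →
                     suc q * size (λ i → R i ∧ not (C i)) ≤ q * size R
  residual-shrinks q R C dense = +-cancelʳ-≤ (size R) _ _ (begin
    suc q * out + size R      ≤⟨ +-monoʳ-≤ (suc q * out) dense ⟩
    suc q * out + suc q * inn ≡⟨ *-distribˡ-+ (suc q) out inn ⟨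
    suc q * (out + inn)       ≡⟨ cong (suc q *_) (trans (+-comm out inn) (sym (size-split R C))) ⟩
    suc q * size R            ≡⟨ +-comm (size R) (q * size R) ⟩
    q * size R + size R       ∎)
    where
    open ≤-Reasoning
    inn = size (λ i → R i ∧ C i)
    out = size (λ i → R i ∧ not (C i))

  module _ {X : Set} {k q : ℕ} (cover : X → Fin k → Bool)
           (dense : ∀ R → ∃[ x ] size R ≤ suc q * size (λ i → R i ∧ cover x i)) where

    greedy-cover : ∀ h (R : Fin k → Bool) → Σ[ xs ∈ (Fin h → X) ]
      size (λ i → R i ∧ not (⋃ (cover ∘ xs) i)) * suc q ^ h ≤ size R * q ^ h
    greedy-cover zero    R = (λ ()) , *-monoˡ-≤ 1 (≤-reflexive (sum-cong-≗ λ i → cong 𝟙 (∧-identityʳ (R i))))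
    greedy-cover (suc h) R with dense R
    ... | x , x-dense with greedy-cover h (λ i → R i ∧ not (cover x i))
    ...   | xs , bound = x ∷ xs , (begin
      size (λ i → R i ∧ not (cover x i ∨ U i)) * (suc q * suc q ^ h)
        ≡⟨ cong (_* (suc q * suc q ^ h)) (sum-cong-≗ λ i → cong 𝟙 (regroup (R i) (cover x i) (U i))) ⟩
      rest * (suc q * suc q ^ h)  ≡⟨ x∙yz≈y∙xz rest (suc q) _ ⟩
      suc q * (rest * suc q ^ h)  ≤⟨ *-monoʳ-≤ (suc q) bound ⟩
      suc q * (size R′ * q ^ h)   ≡⟨ *-assoc (suc q) (size R′) (q ^ h) ⟨
      suc q * size R′ * q ^ h     ≤⟨ *-monoˡ-≤ (q ^ h) (residual-shrinks q R (cover x) x-dense) ⟩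
      q * size R * q ^ h          ≡⟨ xy∙z≈y∙xz q (size R) (q ^ h) ⟩
      size R * (q * q ^ h)        ∎)
      where
      open ≤-Reasoning
      U    = ⋃ (cover ∘ xs)
      R′   = λ i → R i ∧ not (cover x i)
      rest = size (λ i → R′ i ∧ not (U i))
      regroup : ∀ r c u → r ∧ not (c ∨ u) ≡ (r ∧ not c) ∧ not u
      regroup false c     u = refl
      regroup true  true  u = refl
      regroup true  false u = refl

  module _ (p : ℕ) where

    ∑ᴿ : ∀ m → ((Fin m → Fin p) → ℕ) → ℕ
    ∑ᴿ zero    f = f (λ ())
    ∑ᴿ (suc m) f = ∑[ t < p ] ∑ᴿ m (λ r → f (t ∷ r))

    ∑ᴿ-const : ∀ m c → ∑ᴿ m (λ _ → c) ≡ p ^ m * c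
    ∑ᴿ-const zero    c = sym (+-identityʳ c)
    ∑ᴿ-const (suc m) c = begin
      ∑[ t < p ] ∑ᴿ m (λ _ → c) ≡⟨ sum-cong-≗ {p} (λ _ → ∑ᴿ-const m c) ⟩
      ∑[ t < p ] (p ^ m * c)    ≡⟨ ∑-const p (p ^ m * c) ⟩
      p * (p ^ m * c)           ≡⟨ *-assoc p (p ^ m) c ⟨
      p * p ^ m * c             ∎
      where open ≡-Reasoning

    ∑ᴿ-cong : ∀ m {f g : (Fin m → Fin p) → ℕ} → (∀ r → f r ≡ g r) → ∑ᴿ m f ≡ ∑ᴿ m g
    ∑ᴿ-cong zero    f≡g = f≡g _
    ∑ᴿ-cong (suc m) f≡g = sum-cong-≗ {p} λ t → ∑ᴿ-cong m λ r → f≡g (t ∷ r)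

    ∑ᴿ-mono-≤ : ∀ m {f g : (Fin m → Fin p) → ℕ} → (∀ r → f r ≤ g r) → ∑ᴿ m f ≤ ∑ᴿ m g
    ∑ᴿ-mono-≤ zero    f≤g = f≤g _
    ∑ᴿ-mono-≤ (suc m) f≤g = ∑-mono-≤ λ t → ∑ᴿ-mono-≤ m λ r → f≤g (t ∷ r)

    ∑ᴿ-comm : ∀ m {k} (f : (Fin m → Fin p) → Fin k → ℕ) →
              ∑ᴿ m (λ r → ∑[ i < k ] f r i) ≡ ∑[ i < k ] ∑ᴿ m (λ r → f r i)
    ∑ᴿ-comm zero    f = refl
    ∑ᴿ-comm (suc m) f = trans (sum-cong-≗ λ t → ∑ᴿ-comm m (λ r → f (t ∷ r)))
                              (∑-comm {p} (λ t i → ∑ᴿ m (λ r → f (t ∷ r) i)))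

  ∑ᴿ-argmax : ∀ q m (f : (Fin m → Fin (suc q)) → ℕ) → ∃[ r ] ∑ᴿ (suc q) m f ≤ suc q ^ m * f r
  ∑ᴿ-argmax q zero    f = (λ ()) , ≤-reflexive (sym (+-identityʳ _))
  ∑ᴿ-argmax q (suc m) f = t ∷ best t , (begin
    ∑[ t′ < suc q ] ∑ᴿ (suc q) m (λ r → f (t′ ∷ r))
      ≤⟨ ∑-mono-≤ (λ t′ → proj₂ (∑ᴿ-argmax q m (λ r → f (t′ ∷ r)))) ⟩
    ∑[ t′ < suc q ] (suc q ^ m * g t′) ≤⟨ ∑-mono-≤ (λ t′ → *-monoʳ-≤ (suc q ^ m) (max t′)) ⟩
    ∑[ t′ < suc q ] (suc q ^ m * g t)  ≡⟨ ∑-const (suc q) _ ⟩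
    suc q * (suc q ^ m * g t)          ≡⟨ *-assoc (suc q) (suc q ^ m) (g t) ⟨
    suc q ^ suc m * g t                ∎)
    where
    open ≤-Reasoning
    best : Fin (suc q) → Fin m → Fin (suc q)
    best t′ = proj₁ (∑ᴿ-argmax q m (λ r → f (t′ ∷ r)))
    g : Fin (suc q) → ℕ
    g t′ = f (t′ ∷ best t′)
    t   = proj₁ (argmax g)
    max = proj₂ (argmax g)

  averaging : ∀ q m {k} (good : (Fin m → Fin (suc q)) → Fin k → Bool) →
    (∀ i → suc q ^ m ≤ suc q * ∑ᴿ (suc q) m (λ r → 𝟙 (good r i))) →
    ∀ R → ∃[ r ] size R ≤ suc q * size (λ i → R i ∧ good r i)
  averaging q m {k} good often R = r , *-cancelˡ-≤ (p ^ m) {{m^n≢0 p m}} (begin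
    p ^ m * size R                                     ≡⟨ *-distribˡ-sum {k} (p ^ m) _ ⟩
    ∑[ i < k ] (p ^ m * 𝟙 (R i))                       ≤⟨ ∑-mono-≤ pointwise ⟩
    ∑[ i < k ] (p * ∑ᴿ p m (λ r → 𝟙 (R i ∧ good r i))) ≡⟨ *-distribˡ-sum {k} p _ ⟨
    p * ∑[ i < k ] ∑ᴿ p m (λ r → 𝟙 (R i ∧ good r i))   ≡⟨ cong (p *_) (∑ᴿ-comm p m {k} _) ⟨
    p * ∑ᴿ p m (λ r → size (λ i → R i ∧ good r i))     ≤⟨ *-monoʳ-≤ p r-max ⟩
    p * (p ^ m * size (λ i → R i ∧ good r i))          ≡⟨ x∙yz≈y∙xz p (p ^ m) _ ⟩
    p ^ m * (p * size (λ i → R i ∧ good r i))          ∎)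
    where
    open ≤-Reasoning
    p = suc q
    r     = proj₁ (∑ᴿ-argmax q m (λ r → size (λ i → R i ∧ good r i)))
    r-max = proj₂ (∑ᴿ-argmax q m (λ r → size (λ i → R i ∧ good r i)))
    pointwise : ∀ i → p ^ m * 𝟙 (R i) ≤ p * ∑ᴿ p m (λ r → 𝟙 (R i ∧ good r i))
    pointwise i with R i
    ... | true  = ≤-trans (≤-reflexive (*-identityʳ (p ^ m))) (often i)
    ... | false = ≤-trans (≤-reflexive (*-zeroʳ (p ^ m))) z≤n

module Congruences where

  open FiniteSums using (𝟙; ∑-const; ∑-mono-≤; term≤∑; ∑ᴿ; ∑ᴿ-const; ∑ᴿ-cong; ∑ᴿ-mono-≤)
  open import Data.Bool using (Bool; true)
  open import Data.Empty using (⊥-elim)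
  open import Data.Fin using (Fin; zero; suc; toℕ; fromℕ<)
  open import Data.Fin.Properties using (toℕ-fromℕ<; all?)
  open import Data.Integer using (ℤ; +_; -[1+_]; _+_; _*_; -_; _-_; 0ℤ; 1ℤ; ∣_∣)
  import Data.Integer.Properties as ℤ
  open import Data.Integer.Divisibility using () renaming (_∣_ to _∣ᵤ_)
  open import Data.Integer.Divisibility.Signed using (_∣_; _∣?_; ∣ᵤ⇒∣; ∣⇒∣ᵤ; divides; ∣m∣n⇒∣m+n; ∣m∣n⇒∣m-n; ∣n⇒∣m*n)
  open import Data.Integer.DivMod using (_%ℕ_; _/ℕ_; n%ℕd<d; a≡a%ℕn+[a/ℕn]*n)
  open import Data.Integer.Tactic.RingSolver using (solve-∀)
  open import Data.Nat as ℕ using (ℕ; zero; suc; _^_; _≤_)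
  open import Data.Nat.Coprimality using (Coprime; coprime-Bézout)
  import Data.Nat.Divisibility as ℕ
  open import Data.Nat.GCD using (module Bézout)
  open import Data.Nat.Primality using (Prime; prime⇒irreducible; prime⇒nonZero)
  open import Data.Nat.Properties using (≤-reflexive; *-monoʳ-≤; *-identityʳ; +-*-semiring; module ≤-Reasoning)
  open import Data.Product using (∃-syntax; _,_; proj₁; proj₂)
  open import Data.Sum using (inj₁; inj₂)
  open import Data.Vec.Functional using (_∷_)
  open import Function using (_∘_)
  open import Relation.Binary.PropositionalEquality
  open import Relation.Nullary using (¬_; yes; no; does)
  open import Relation.Nullary.Decidable using (dec-true)
  open import Relation.Nullary.Negation using (contradiction)
  open import Algebra.Properties.Semiring.Sum +-*-semiring using (sum-syntax; sum-cong-≗; *-distribˡ-sum)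
  import Algebra.Properties.Semiring.Sum ℤ.+-*-semiring as ℤΣ

  module _ (p : ℕ) where

    divisible? : ℤ → Bool
    divisible? z = does (p ℕ.∣? ∣ z ∣)

    divisible?-sound : ∀ {z} → divisible? z ≡ true → + p ∣ᵤ z
    divisible?-sound {z} eq with p ℕ.∣? ∣ z ∣
    ... | yes p∣z = p∣z
    ... | no  _   = contradiction eq λ ()

    dot : ∀ {m} → (Fin m → Fin p) → (Fin m → ℤ) → ℤ
    dot r a = ℤΣ.sum (λ j → + toℕ (r j) * a j)

    dot-divisible : ∀ {m} (r : Fin m → Fin p) (a : Fin m → ℤ) → (∀ j → + p ∣ a j) → + p ∣ dot r a
    dot-divisible {zero}  r a p∣a = divides 0ℤ refl
    dot-divisible {suc m} r a p∣a = ∣m∣n⇒∣m+n (∣n⇒∣m*n (+ toℕ (r zero)) (p∣a zero))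
                                              (dot-divisible (r ∘ suc) (a ∘ suc) (p∣a ∘ suc))

  minus-dot-∷ : ∀ {p m} c (t : Fin p) (r : Fin m → Fin p) (a : Fin (suc m) → ℤ) →
                c - dot p (t ∷ r) a ≡ (c - + toℕ t * a zero) - dot p r (a ∘ suc)
  minus-dot-∷ c t r a = minus-+ c (+ toℕ t * a zero) _
    where
    minus-+ : ∀ x y z → x - (y + z) ≡ (x - y) - z
    minus-+ = solve-∀

  toℤ-1+*≡* : ∀ a b c d → 1 ℕ.+ a ℕ.* b ≡ c ℕ.* d → 1ℤ + + a * + b ≡ + c * + d
  toℤ-1+*≡* a b c d eq = begin
    1ℤ + + a * + b    ≡⟨ cong (_+_ 1ℤ) (ℤ.pos-* a b) ⟨
    1ℤ + + (a ℕ.* b)  ≡⟨ ℤ.pos-+ 1 (a ℕ.* b) ⟨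
    + (1 ℕ.+ a ℕ.* b) ≡⟨ cong +_ eq ⟩
    + (c ℕ.* d)       ≡⟨ ℤ.pos-* c d ⟩
    + c * + d         ∎
    where open ≡-Reasoning

  module _ {p : ℕ} (p-prime : Prime p) where

    prime∤⇒coprime : ∀ {A} → ¬ p ℕ.∣ A → Coprime A p
    prime∤⇒coprime p∤A (d∣A , d∣p) with prime⇒irreducible p-prime d∣p
    ... | inj₁ d≡1  = d≡1
    ... | inj₂ refl = contradiction d∣A p∤A

    inverse-ℕ : ∀ A → ¬ p ℕ.∣ A → ∃[ u ] + p ∣ u * + A - 1ℤ
    inverse-ℕ A p∤A with coprime-Bézout (prime∤⇒coprime p∤A)
    ... | Bézout.+- x y eq = + x , divides (+ y) (begin
      + x * + A - 1ℤ      ≡⟨ cong (_- 1ℤ) (toℤ-1+*≡* y p x A eq) ⟨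
      1ℤ + + y * + p - 1ℤ ≡⟨ plus-minus (+ y * + p) ⟩
      + y * + p           ∎)
      where
      open ≡-Reasoning
      plus-minus : ∀ z → 1ℤ + z - 1ℤ ≡ z
      plus-minus = solve-∀
    ... | Bézout.-+ x y eq = - + x , divides (- + y) (begin
      - + x * + A - 1ℤ    ≡⟨ neg-minus (+ x) (+ A) ⟩
      - (1ℤ + + x * + A)  ≡⟨ cong -_ (toℤ-1+*≡* x A y p eq) ⟩
      - (+ y * + p)       ≡⟨ ℤ.neg-distribˡ-* (+ y) (+ p) ⟩
      - + y * + p         ∎)
      where
      open ≡-Reasoning
      neg-minus : ∀ u v → - u * v - 1ℤ ≡ - (1ℤ + u * v)
      neg-minus = solve-∀

    inverse-mod : ∀ a → ¬ + p ∣ a → ∃[ u ] + p ∣ u * a - 1ℤ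
    inverse-mod (+ A)    p∤a = inverse-ℕ A (p∤a ∘ ∣ᵤ⇒∣)
    inverse-mod -[1+ A ] p∤a with inverse-ℕ (suc A) (p∤a ∘ ∣ᵤ⇒∣)
    ... | u , p∣uA-1 = - u , subst (+ p ∣_) (neg-neg u (+ suc A)) p∣uA-1
      where
      neg-neg : ∀ u v → u * v - 1ℤ ≡ - u * - v - 1ℤ
      neg-neg = solve-∀

    root-mod : ∀ a → ¬ + p ∣ a → ∀ c → ∃[ t ] + p ∣ c - + toℕ {p} t * a
    root-mod a p∤a c with inverse-mod a p∤a
    ... | u , p∣ua-1 = t , subst (+ p ∣_) (sym split)
                             (∣m∣n⇒∣m+n (∣n⇒∣m*n (- c) p∣ua-1) (divides (Q * a) refl))
      where
      instance _ = prime⇒nonZero p-prime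
      Q = (c * u) /ℕ p
      t = fromℕ< (n%ℕd<d (c * u) p)
      remainder : + toℕ t ≡ c * u - Q * + p
      remainder = begin
        + toℕ t                              ≡⟨ cong +_ (toℕ-fromℕ< _) ⟩
        + ((c * u) %ℕ p)                     ≡⟨ plus-minus _ (Q * + p) ⟩
        + ((c * u) %ℕ p) + Q * + p - Q * + p ≡⟨ cong (_- Q * + p) (a≡a%ℕn+[a/ℕn]*n (c * u) p) ⟨
        c * u - Q * + p                      ∎
        where
        open ≡-Reasoning
        plus-minus : ∀ x y → x ≡ x + y - y
        plus-minus = solve-∀
      split : c - + toℕ t * a ≡ - c * (u * a - 1ℤ) + Q * a * + p
      split = begin
        c - + toℕ t * a                  ≡⟨ cong (λ v → c - v * a) remainder ⟩
        c - (c * u - Q * + p) * a        ≡⟨ regroup c u a Q (+ p) ⟩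
        - c * (u * a - 1ℤ) + Q * a * + p ∎
        where
        open ≡-Reasoning
        regroup : ∀ c u a Q P → c - (c * u - Q * P) * a ≡ - c * (u * a - 1ℤ) + Q * a * P
        regroup = solve-∀

    roots-dense : ∀ m (a : Fin m → ℤ) → ¬ (∀ j → + p ∣ a j) → ∀ c →
                  p ^ m ≤ p ℕ.* ∑ᴿ p m (λ r → 𝟙 (divisible? p (c - dot p r a)))
    roots-dense zero    a not-all c = ⊥-elim (not-all λ ())
    roots-dense (suc m) a not-all c with all? (λ j → + p ∣? a (suc j))
    ... | yes tail-divisible = *-monoʳ-≤ p (begin
      p ^ m              ≡⟨ *-identityʳ (p ^ m) ⟨
      p ^ m ℕ.* 1        ≡⟨ ∑ᴿ-const p m 1 ⟨
      ∑ᴿ p m (λ _ → 1)   ≤⟨ ∑ᴿ-mono-≤ p m (λ r → ≤-reflexive (cong 𝟙 (sym (root-slice r)))) ⟩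
      ∑ᴿ p m (λ r → 𝟙 (divisible? p (c - dot p (t ∷ r) a))) ≤⟨ term≤∑ _ t ⟩
      ∑ᴿ p (suc m) (λ r → 𝟙 (divisible? p (c - dot p r a))) ∎)
      where
      open ≤-Reasoning
      head-indivisible : ¬ + p ∣ a zero
      head-indivisible p∣a₀ = not-all λ { zero → p∣a₀ ; (suc j) → tail-divisible j }
      root = root-mod (a zero) head-indivisible c
      t = proj₁ root
      root-slice : ∀ r → divisible? p (c - dot p (t ∷ r) a) ≡ true
      root-slice r = dec-true (p ℕ.∣? _) (∣⇒∣ᵤ (subst (+ p ∣_) (sym (minus-dot-∷ c t r a))
        (∣m∣n⇒∣m-n (proj₂ root) (dot-divisible p r (a ∘ suc) tail-divisible))))
    ... | no tail-indivisible = begin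
      p ℕ.* p ^ m
        ≡⟨ ∑-const p (p ^ m) ⟨
      ∑[ t < p ] (p ^ m)
        ≤⟨ ∑-mono-≤ {p} (λ t → roots-dense m (a ∘ suc) tail-indivisible (c - + toℕ t * a zero)) ⟩
      ∑[ t < p ] (p ℕ.* ∑ᴿ p m (λ r → 𝟙 (divisible? p ((c - + toℕ t * a zero) - dot p r (a ∘ suc)))))
        ≡⟨ *-distribˡ-sum {p} p _ ⟨
      p ℕ.* ∑[ t < p ] ∑ᴿ p m (λ r → 𝟙 (divisible? p ((c - + toℕ t * a zero) - dot p r (a ∘ suc))))
        ≡⟨ cong (p ℕ.*_) (sum-cong-≗ {p} λ t → ∑ᴿ-cong p m λ r → cong (𝟙 ∘ divisible? p) (minus-dot-∷ c t r a)) ⟨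
      p ℕ.* ∑ᴿ p (suc m) (λ r → 𝟙 (divisible? p (c - dot p r a)))
        ∎
      where open ≤-Reasoning

module Evaluation where

  open import Defs
  open import Data.Fin using (Fin; zero; suc; toℕ)
  open import Data.Integer using (ℤ; +_; _+_; _*_; -_; 0ℤ)
  import Data.Integer.Properties as ℤ
  open import Data.List as List using ([]; _∷_; _++_; foldr; tabulate)
  open import Data.List.Properties using (++-identityʳ)
  open import Data.Nat using (ℕ; zero; suc)
  import Data.Nat as ℕ
  import Data.Nat.Properties as ℕ
  open import Data.Product using (_×_; _,_)
  import Data.Vec as Vec
  open import Data.Vec.Properties using (zipWith-identityˡ)
  open import Function using (_∘_; id)
  open import Relation.Binary.PropositionalEquality
  import Algebra.Properties.Semiring.Sum ℤ.+-*-semiring as ℤΣ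

  module _ {p n : ℕ} (ω : LinMap p n) where

    term : ℤ × Monomial n → ℤ
    term (c , m) = c * + toℕ (ω m)

    evalNF : NF n → ℤ
    evalNF = foldr (λ x acc → term x + acc) 0ℤ

    evalNF-++ : ∀ xs ys → evalNF (xs ++ ys) ≡ evalNF xs + evalNF ys
    evalNF-++ []       ys = sym (ℤ.+-identityˡ _)
    evalNF-++ (x ∷ xs) ys = trans (cong (_+_ (term x)) (evalNF-++ xs ys)) (sym (ℤ.+-assoc (term x) _ _))

    evalNF-map : ∀ (f : ℤ × Monomial n → ℤ × Monomial n) (φ : ℤ → ℤ) →
                 (∀ a b → φ (a + b) ≡ φ a + φ b) → φ 0ℤ ≡ 0ℤ → (∀ x → term (f x) ≡ φ (term x)) →
                 ∀ xs → evalNF (List.map f xs) ≡ φ (evalNF xs)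
    evalNF-map f φ φ-+ φ-0 φ-term []       = sym φ-0
    evalNF-map f φ φ-+ φ-0 φ-term (x ∷ xs) =
      trans (cong₂ _+_ (φ-term x) (evalNF-map f φ φ-+ φ-0 φ-term xs)) (sym (φ-+ _ _))

    applyLin-0 : applyLin ω (con 0ℤ) ≡ 0ℤ
    applyLin-0 = trans (ℤ.+-identityʳ _) (ℤ.*-zeroˡ (+ toℕ (ω (Vec.replicate n 0))))

    applyLin-⊕ : ∀ a b → applyLin ω (a ⊕ b) ≡ applyLin ω a + applyLin ω b
    applyLin-⊕ a b = evalNF-++ (nf a) (nf b)

    applyLin-⊖ : ∀ a → applyLin ω (⊖ a) ≡ - applyLin ω a
    applyLin-⊖ a = evalNF-map _ -_ ℤ.neg-distrib-+ refl (λ (c , m) → sym (ℤ.neg-distribˡ-* c _)) (nf a)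

    applyLin-con-⊗ : ∀ c a → applyLin ω (con c ⊗ a) ≡ c * applyLin ω a
    applyLin-con-⊗ c a = begin
      evalNF (List.map scale (nf a) ++ []) ≡⟨ cong evalNF (++-identityʳ (List.map scale (nf a))) ⟩
      evalNF (List.map scale (nf a))       ≡⟨ evalNF-map scale (c *_) (ℤ.*-distribˡ-+ c) (ℤ.*-zeroʳ c) scale-term (nf a) ⟩
      c * evalNF (nf a)                    ∎
      where
      open ≡-Reasoning
      scale : ℤ × Monomial n → ℤ × Monomial n
      scale (c′ , m) = c * c′ , Vec.zipWith ℕ._+_ (Vec.replicate n 0) m
      scale-term : ∀ x → term (scale x) ≡ c * term x
      scale-term (c′ , m) = trans (cong (λ m′ → c * c′ * + toℕ (ω m′)) (zipWith-identityˡ ℕ.+-identityˡ m))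
                                  (ℤ.*-assoc c c′ _)

    applyLin-foldr-⊕ : ∀ {m k} (f : Fin k → Expr (Fin n)) (g : Fin m → Fin k) →
      applyLin ω (foldr (λ j acc → f j ⊕ acc) (con 0ℤ) (tabulate g)) ≡ ℤΣ.sum (λ j → applyLin ω (f (g j)))
    applyLin-foldr-⊕ {zero}  f g = applyLin-0
    applyLin-foldr-⊕ {suc m} f g =
      trans (applyLin-⊕ (f (g zero)) (foldr (λ j acc → f j ⊕ acc) (con 0ℤ) (tabulate (g ∘ suc))))
            (cong (_+_ (applyLin ω (f (g zero)))) (applyLin-foldr-⊕ f (g ∘ suc)))

    applyLin-bigSum : ∀ {m} (f : Fin m → Expr (Fin n)) → applyLin ω (bigSum m f) ≡ ℤΣ.sum (λ j → applyLin ω (f j))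
    applyLin-bigSum f = applyLin-foldr-⊕ f id

module ExponentialBound where

  open import Defs using (expNum)
  open import Data.Nat
  open import Data.Nat.Properties
  open import Data.Nat.Divisibility using (m≤n⇒m!∣n!)
  open import Data.Nat.DivMod using (_/_; m/n*n≡m)
  open import Data.Nat.ListAction using (sum)
  open import Data.Nat.ListAction.Properties using (sum-++)
  open import Data.Nat.Tactic.RingSolver using (solve-∀)
  open import Data.List using ([]; _∷_; _++_; map; upTo; _∷ʳ_)
  open import Data.List.Properties using (upTo-∷ʳ; map-++)
  open import Data.List.Relation.Unary.All as All using (All; []; _∷_)
  open import Data.List.Relation.Unary.All.Properties using (all-upTo)
  open import Function using (_∘_)
  open import Relation.Binary.PropositionalEquality
  open import Algebra.Properties.CommutativeSemigroup *-commutativeSemigroup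
    using (x∙yz≈y∙xz; xy∙z≈y∙xz; x∙yz≈yx∙z; x∙yz≈y∙zx)

  -- multichoose h j = C(h + j − 1, j)
  multichoose : ℕ → ℕ → ℕ
  multichoose h       zero    = 1
  multichoose zero    (suc j) = 0
  multichoose (suc h) (suc j) = multichoose (suc h) j + multichoose h (suc j)

  multichoose-1 : ∀ h → multichoose h 1 ≡ h
  multichoose-1 zero    = refl
  multichoose-1 (suc h) = cong suc (multichoose-1 h)

  multichoose-rising : ∀ h j → suc j * multichoose h (suc j) ≡ (h + j) * multichoose h j
  multichoose-rising zero    j       = trans (*-zeroʳ (suc j)) (sym (vanishes j))
    where
    vanishes : ∀ j → j * multichoose 0 j ≡ 0
    vanishes zero    = refl
    vanishes (suc j) = *-zeroʳ (suc j)
  multichoose-rising (suc h) zero    =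
    trans (+-identityʳ _) (trans (cong suc (multichoose-1 h)) (sym (trans (*-identityʳ _) (+-identityʳ _))))
  multichoose-rising (suc h) (suc j) = begin
    suc (suc j) * (A + B + C)
      ≡⟨ regroup j A B C ⟩
    (suc j * (A + B) + (A + B)) + suc (suc j) * C
      ≡⟨ cong₂ (λ x y → x + (A + B) + y) (multichoose-rising (suc h) j) (multichoose-rising h (suc j)) ⟩
    (suc h + j) * A + (A + B) + (h + suc j) * B
      ≡⟨ collect h j A B ⟩
    (suc h + suc j) * (A + B) ∎
    where
    open ≡-Reasoning
    A = multichoose (suc h) j
    B = multichoose h (suc j)
    C = multichoose h (suc (suc j))
    regroup : ∀ j A B C → suc (suc j) * (A + B + C) ≡ (suc j * (A + B) + (A + B)) + suc (suc j) * C
    regroup = solve-∀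
    collect : ∀ h j A B → (suc h + j) * A + (A + B) + (h + suc j) * B ≡ (suc h + suc j) * (A + B)
    collect = solve-∀

  pow≤!*multichoose : ∀ h j → h ^ j ≤ j ! * multichoose h j
  pow≤!*multichoose h zero    = ≤-refl
  pow≤!*multichoose h (suc j) = begin
    h * h ^ j                             ≤⟨ *-monoʳ-≤ h (pow≤!*multichoose h j) ⟩
    h * (j ! * multichoose h j)           ≤⟨ *-monoˡ-≤ _ (m≤m+n h j) ⟩
    (h + j) * (j ! * multichoose h j)     ≡⟨ x∙yz≈y∙xz (h + j) (j !) _ ⟩
    j ! * ((h + j) * multichoose h j)     ≡⟨ cong (j ! *_) (multichoose-rising h j) ⟨
    j ! * (suc j * multichoose h (suc j)) ≡⟨ x∙yz≈yx∙z (j !) (suc j) _ ⟩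
    suc j * j ! * multichoose h (suc j)   ∎
    where open ≤-Reasoning

  module _ (q : ℕ) where

    -- series h N = Σ_{j ≤ N} multichoose h j · p^(N − j) with p = q + 1: p^N times a
    -- partial sum of (1 − 1/p)^(−h) = Σ_j multichoose h j / p^j.
    series : ℕ → ℕ → ℕ
    series h zero    = 1
    series h (suc N) = suc q * series h N + multichoose h (suc N)

    series-step : ∀ h N → q * series (suc h) N + multichoose (suc h) N ≡ suc q * series h N
    series-step h zero    = trans (+-comm (q * 1) 1) (cong suc (trans (*-identityʳ q) (sym (*-identityʳ q))))
    series-step h (suc N) = begin
      q * (suc q * S′ + (A + B)) + (A + B)     ≡⟨ regroup q S′ A B ⟩
      suc q * (q * S′ + A) + suc q * B         ≡⟨ cong (λ x → suc q * x + suc q * B) (series-step h N) ⟩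
      suc q * (suc q * series h N) + suc q * B ≡⟨ *-distribˡ-+ (suc q) _ B ⟨
      suc q * (suc q * series h N + B)         ∎
      where
      open ≡-Reasoning
      S′ = series (suc h) N
      A  = multichoose (suc h) N
      B  = multichoose h (suc N)
      regroup : ∀ q S A B → q * (suc q * S + (A + B)) + (A + B) ≡ suc q * (q * S + A) + suc q * B
      regroup = solve-∀

    series-bound : ∀ h N → q ^ h * series h N ≤ suc q ^ h * suc q ^ N
    series-bound zero    N = ≤-reflexive (trans (*-identityˡ _) (trans (powers N) (sym (*-identityˡ _))))
      where
      powers : ∀ N → series 0 N ≡ suc q ^ N
      powers zero    = refl
      powers (suc N) = trans (+-identityʳ _) (cong (suc q *_) (powers N))
    series-bound (suc h) N = begin
      q * q ^ h * series (suc h) N                           ≡⟨ xy∙z≈y∙xz q (q ^ h) _ ⟩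
      q ^ h * (q * series (suc h) N)                         ≤⟨ *-monoʳ-≤ (q ^ h) (m≤m+n _ (multichoose (suc h) N)) ⟩
      q ^ h * (q * series (suc h) N + multichoose (suc h) N) ≡⟨ cong (q ^ h *_) (series-step h N) ⟩
      q ^ h * (suc q * series h N)                           ≡⟨ x∙yz≈y∙xz (q ^ h) (suc q) _ ⟩
      suc q * (q ^ h * series h N)                           ≤⟨ *-monoʳ-≤ (suc q) (series-bound h N) ⟩
      suc q * (suc q ^ h * suc q ^ N)                        ≡⟨ *-assoc (suc q) (suc q ^ h) (suc q ^ N) ⟨
      suc q * suc q ^ h * suc q ^ N                          ∎
      where open ≤-Reasoning

  sum-map-mono-≤ : ∀ {A : Set} {f g : A → ℕ} {xs} → All (λ x → f x ≤ g x) xs → sum (map f xs) ≤ sum (map g xs)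
  sum-map-mono-≤ []           = ≤-refl
  sum-map-mono-≤ (fx≤gx ∷ ps) = +-mono-≤ fx≤gx (sum-map-mono-≤ ps)

  sum-map-cong : ∀ {A : Set} {f g : A → ℕ} {xs} → All (λ x → f x ≡ g x) xs → sum (map f xs) ≡ sum (map g xs)
  sum-map-cong []           = refl
  sum-map-cong (fx≡gx ∷ ps) = cong₂ _+_ fx≡gx (sum-map-cong ps)

  sum-map-*ˡ : ∀ {A : Set} c (f : A → ℕ) xs → sum (map (λ x → c * f x) xs) ≡ c * sum (map f xs)
  sum-map-*ˡ c f []       = sym (*-zeroʳ c)
  sum-map-*ˡ c f (x ∷ xs) = trans (cong (c * f x +_) (sum-map-*ˡ c f xs)) (sym (*-distribˡ-+ c (f x) _))

  module _ (q h : ℕ) where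

    series-as-sum : ∀ N → series q h N ≡ sum (map (λ j → multichoose h j * suc q ^ (N ∸ j)) (upTo (suc N)))
    series-as-sum zero    = refl
    series-as-sum (suc N) = begin
      suc q * series q h N + multichoose h (suc N)
        ≡⟨ cong (λ s → suc q * s + multichoose h (suc N)) (series-as-sum N) ⟩
      suc q * sum (map F′ (upTo (suc N))) + multichoose h (suc N)
        ≡⟨ cong₂ _+_ (sym (sum-map-*ˡ (suc q) F′ (upTo (suc N)))) (sym last-term) ⟩
      sum (map (λ j → suc q * F′ j) (upTo (suc N))) + sum (map F (suc N ∷ []))
        ≡⟨ cong (λ s → s + sum (map F (suc N ∷ []))) (sum-map-cong (All.map shift (all-upTo (suc N)))) ⟩
      sum (map F (upTo (suc N))) + sum (map F (suc N ∷ []))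
        ≡⟨ sum-++ (map F (upTo (suc N))) _ ⟨
      sum (map F (upTo (suc N)) ++ map F (suc N ∷ []))
        ≡⟨ cong sum (map-++ F (upTo (suc N)) (suc N ∷ [])) ⟨
      sum (map F (upTo (suc N) ∷ʳ suc N))
        ≡⟨ cong (sum ∘ map F) (upTo-∷ʳ (suc N)) ⟩
      sum (map F (upTo (suc (suc N))))
        ∎
      where
      open ≡-Reasoning
      F′ F : ℕ → ℕ
      F′ j = multichoose h j * suc q ^ (N ∸ j)
      F  j = multichoose h j * suc q ^ (suc N ∸ j)
      last-term : F (suc N) + 0 ≡ multichoose h (suc N)
      last-term = trans (+-identityʳ _) (trans (cong (λ e → multichoose h (suc N) * suc q ^ e) (n∸n≡0 N)) (*-identityʳ _))
      shift : ∀ {j} → j < suc N → suc q * F′ j ≡ F j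
      shift {j} (s≤s j≤N) = trans (x∙yz≈y∙xz (suc q) (multichoose h j) _)
                                  (cong (λ e → multichoose h j * suc q ^ e) (sym (+-∸-assoc 1 j≤N)))

    expNum≤ : ∀ N → expNum h (suc q) N ≤ N ! * series q h N
    expNum≤ N = begin
      expNum h (suc q) N
        ≤⟨ sum-map-mono-≤ (All.map term≤ (all-upTo (suc N))) ⟩
      sum (map (λ j → N ! * (multichoose h j * suc q ^ (N ∸ j))) (upTo (suc N)))
        ≡⟨ sum-map-*ˡ (N !) _ (upTo (suc N)) ⟩
      N ! * sum (map (λ j → multichoose h j * suc q ^ (N ∸ j)) (upTo (suc N)))
        ≡⟨ cong (N ! *_) (series-as-sum N) ⟨
      N ! * series q h N
        ∎
      where
      open ≤-Reasoning
      term≤ : ∀ {j} → j < suc N →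
              h ^ j * suc q ^ (N ∸ j) * ((N !) / (j !)) {{j !≢0}} ≤ N ! * (multichoose h j * suc q ^ (N ∸ j))
      term≤ {j} (s≤s j≤N) = begin
        h ^ j * P * Q                   ≤⟨ *-monoˡ-≤ Q (*-monoˡ-≤ P (pow≤!*multichoose h j)) ⟩
        j ! * multichoose h j * P * Q   ≡⟨ regroup (j !) (multichoose h j) P Q ⟩
        Q * j ! * (multichoose h j * P) ≡⟨ cong (_* (multichoose h j * P)) (m/n*n≡m {{j !≢0}} (m≤n⇒m!∣n! j≤N)) ⟩
        N ! * (multichoose h j * P)     ∎
        where
        P = suc q ^ (N ∸ j)
        Q = ((N !) / (j !)) {{j !≢0}}
        regroup : ∀ a b c d → a * b * c * d ≡ d * a * (b * c)
        regroup = solve-∀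

    exp-bound : ∀ N → q ^ h * expNum h (suc q) N ≤ suc q ^ h * (suc q ^ N * N !)
    exp-bound N = begin
      q ^ h * expNum h (suc q) N    ≤⟨ *-monoʳ-≤ (q ^ h) (expNum≤ N) ⟩
      q ^ h * (N ! * series q h N)  ≡⟨ x∙yz≈y∙xz (q ^ h) (N !) _ ⟩
      N ! * (q ^ h * series q h N)  ≤⟨ *-monoʳ-≤ (N !) (series-bound q h N) ⟩
      N ! * (suc q ^ h * suc q ^ N) ≡⟨ x∙yz≈y∙zx (N !) (suc q ^ h) _ ⟩
      suc q ^ h * (suc q ^ N * N !) ∎
      where open ≤-Reasoning

module Assignments where

  open import Defs
  open FiniteSums
  open Congruences using (divisible?; divisible?-sound; dot; roots-dense)
  open Evaluation using (applyLin-⊕; applyLin-⊖; applyLin-con-⊗; applyLin-bigSum)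
  open import Data.Bool using (Bool; true; false; _∨_; not)
  open import Data.Bool.Properties using (∨-conicalˡ; ∨-conicalʳ; not-injective)
  open import Data.Fin using (Fin; zero; suc; toℕ)
  open import Data.Fin.Properties using (all?)
  open import Data.Integer as ℤ using (+_; _-_; 1ℤ)
  import Data.Integer.Properties as ℤ
  open import Data.Integer.Divisibility.Signed using (_∣_; _∣?_; ∣⇒∣ᵤ)
  open import Data.List as List using (List; []; _∷_; allFin; length; lookup)
  open import Data.List.Relation.Unary.All using (All; [])
  open import Data.List.Relation.Unary.All.Properties as All using (++⁺; concat⁺)
  open import Data.List.Relation.Unary.Any using (Any; here; there)
  import Data.List.Relation.Unary.Any.Properties as Any
  open import Data.Nat using (ℕ; zero; suc; _+_; _*_; _^_; _≤_; z≤n; s≤s)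
  open import Data.Nat.ListAction using (sum)
  open import Data.Nat.Properties
  open import Data.Nat.Primality using (Prime)
  open import Data.Product using (_,_; proj₁; proj₂)
  open import Data.Sum using ([_,_])
  open import Data.Unit using (tt)
  open import Function using (_∘_)
  open import Relation.Binary.PropositionalEquality hiding ([_])
  open import Relation.Nullary using (Dec; yes; no; does)
  open import Algebra.Properties.Semiring.Sum +-*-semiring using (sum-syntax; *-distribʳ-sum)
  import Algebra.Properties.Semiring.Sum ℤ.+-*-semiring as ℤΣ

  ∑-lookup : ∀ {A : Set} (f : A → ℕ) (xs : List A) → ∑[ u < length xs ] f (lookup xs u) ≡ sum (List.map f xs)
  ∑-lookup f []       = refl
  ∑-lookup f (x ∷ xs) = cong (_+_ (f x)) (∑-lookup f xs)

  extensionFactor : ∀ {X : Set} {m p} → (Fin m → Expr X) → (Fin m → Fin p) → Expr X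
  extensionFactor {m = m} G r = con (+ 1) ⊕ (⊖ bigSum m (λ j → con (+ toℕ (r j)) ⊗ G j))

  groupFactors : ∀ {X : Set} {m p} h → (Fin m → Expr X) → (Fin h → Fin m → Fin p) → List (List (Expr X))
  groupFactors h G rows = List.map (λ j → G j ∷ List.map (λ u → extensionFactor G (rows u)) (allFin h)) (allFin _)

  applyLin-extensionFactor : ∀ {p n m} (ω : LinMap p n) (G : Fin m → Expr (Fin n)) r →
    applyLin ω (extensionFactor G r) ≡ applyLin ω (con 1ℤ) - dot p r (λ j → applyLin ω (G j))
  applyLin-extensionFactor {m = m} ω G r = begin
    applyLin ω (extensionFactor G r)                       ≡⟨ applyLin-⊕ ω (con 1ℤ) (⊖ bigSum m F) ⟩
    applyLin ω (con 1ℤ) ℤ.+ applyLin ω (⊖ bigSum m F)      ≡⟨ cong (ℤ._+_ (applyLin ω (con 1ℤ))) (applyLin-⊖ ω (bigSum m F)) ⟩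
    applyLin ω (con 1ℤ) - applyLin ω (bigSum m F)          ≡⟨ cong (applyLin ω (con 1ℤ) -_) (applyLin-bigSum ω F) ⟩
    applyLin ω (con 1ℤ) - ℤΣ.sum (λ j → applyLin ω (F j)) ≡⟨ cong (applyLin ω (con 1ℤ) -_)
                                                                (ℤΣ.sum-cong-≗ {m} λ j → applyLin-con-⊗ ω (+ toℕ (r j)) (G j)) ⟩
    applyLin ω (con 1ℤ) - dot _ r (λ j → applyLin ω (G j)) ∎
    where
    open ≡-Reasoning
    F = λ j → con (+ toℕ (r j)) ⊗ G j

  AnnihilatedOutside : ∀ {p n k} → (Fin k → LinMap p n) → (Fin k → Bool) → List (List (Expr (Fin n))) → Set
  AnnihilatedOutside Ω bad fss = ∀ i → bad i ≡ false → All (Any (Vanishes (Ω i))) fss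

  module _ {q n k : ℕ} (Ω : Fin k → LinMap (suc q) n) (h : ℕ) where

    private
      p = suc q

    record GoodAssignment (Values : Set) (factors : Values → List (List (Expr (Fin n)))) (weight : ℕ) : Set where
      field
        values      : Values
        bad         : Fin k → Bool
        annihilated : AnnihilatedOutside Ω bad (factors values)
        few-bad     : size bad * p ^ h ≤ weight * (k * q ^ h)

    open GoodAssignment

    reweigh : ∀ {Values factors w w′} → w ≤ w′ → GoodAssignment Values factors w → GoodAssignment Values factors w′
    reweigh w≤w′ g = record
      { values = values g ; bad = bad g ; annihilated = annihilated g ; few-bad = ≤-trans (few-bad g) (*-monoˡ-≤ _ w≤w′) }

    unconstrained : ∀ {Values factors} weight (v : Values) → factors v ≡ [] → GoodAssignment Values factors weight
    unconstrained weight v no-factors = record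
      { values      = v
      ; bad         = λ _ → false
      ; annihilated = λ _ _ → subst (All _) (sym no-factors) []
      ; few-bad     = ≤-trans (≤-reflexive (cong (_* p ^ h) (size-empty {k}))) z≤n
      }

    module _ (p-prime : Prime p) where

      module _ {m} (G : Fin m → Expr (Fin n)) where

        all-vanish? : ∀ i → Dec (∀ j → + p ∣ applyLin (Ω i) (G j))
        all-vanish? i = all? (λ j → + p ∣? applyLin (Ω i) (G j))

        serves : (Fin m → Fin p) → Fin k → Bool
        serves r i = does (all-vanish? i) ∨ divisible? p (applyLin (Ω i) (extensionFactor G r))

        serves-often : ∀ i → p ^ m ≤ p * ∑ᴿ p m (λ r → 𝟙 (serves r i))
        serves-often i = often (all-vanish? i)
          where
          often : (d : Dec (∀ j → + p ∣ applyLin (Ω i) (G j))) →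
                  p ^ m ≤ p * ∑ᴿ p m (λ r → 𝟙 (does d ∨ divisible? p (applyLin (Ω i) (extensionFactor G r))))
          often (yes _)      = ≤-trans (m≤n*m (p ^ m) p)
                                 (*-monoʳ-≤ p (≤-reflexive (sym (trans (∑ᴿ-const p m 1) (*-identityʳ _)))))
          often (no not-all) = subst (λ s → p ^ m ≤ p * s)
            (∑ᴿ-cong p m λ r → cong (𝟙 ∘ divisible? p) (sym (applyLin-extensionFactor (Ω i) G r)))
            (roots-dense p-prime m (λ j → applyLin (Ω i) (G j)) not-all (applyLin (Ω i) (con 1ℤ)))

        served⇒annihilated : ∀ {rows : Fin h → Fin m → Fin p} i u → serves (rows u) i ≡ true →
                             All (Any (Vanishes (Ω i))) (groupFactors h G rows)
        served⇒annihilated {rows} i u = from (all-vanish? i)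
          where
          from : (d : Dec (∀ j → + p ∣ applyLin (Ω i) (G j))) →
                 does d ∨ divisible? p (applyLin (Ω i) (extensionFactor G (rows u))) ≡ true →
                 All (Any (Vanishes (Ω i))) (groupFactors h G rows)
          from (yes all-vanish) _ = All.map⁺ (All.tabulate⁺ λ j → here (∣⇒∣ᵤ (all-vanish j)))
          from (no _) u-vanishes  = All.map⁺ (All.tabulate⁺ λ j → there (Any.map⁺ (Any.tabulate⁺ u
            (divisible?-sound p {applyLin (Ω i) (extensionFactor G (rows u))} u-vanishes))))

      greedy-group : ∀ m (G : Fin m → Expr (Fin n)) → GoodAssignment (Fin h → Fin m → Fin p) (groupFactors h G) 1
      greedy-group m G = record
        { values      = rows
        ; bad         = unserved
        ; annihilated = λ i unserved≡false →
            let u , served = ⋃-true (serves G ∘ rows) i (not-injective unserved≡false) in served⇒annihilated G i u served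
        ; few-bad     = subst (λ s → size unserved * p ^ h ≤ s) (sym (*-identityˡ _))
                          (subst (λ s → size unserved * p ^ h ≤ s * q ^ h) (size-full {k}) (proj₂ chosen))
        }
        where
        chosen = greedy-cover (serves G) (averaging q m (serves G) (serves-often G)) h (λ _ → true)
        rows = proj₁ chosen
        unserved : Fin k → Bool
        unserved i = not (⋃ (serves G ∘ rows) i)

      group-assignment : ∀ m (G : Fin m → Expr (Fin n)) → GoodAssignment (Fin h → Fin m → Fin p) (groupFactors h G) m
      group-assignment zero    G = unconstrained 0 (λ _ ()) refl
      group-assignment (suc m) G = reweigh (s≤s z≤n) (greedy-group (suc m) G)

      level-assignment : ∀ {V : Set} (L : List (Group V)) (σ : V → Expr (Fin n)) →
                         GoodAssignment (LVar h L → Fin p) (levelFactors L σ) (sum (List.map Group.m L))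
      level-assignment L σ = record
        { values      = λ (u , v , j) → values (per-group u) v j
        ; bad         = ⋃ (bad ∘ per-group)
        ; annihilated = λ i none → concat⁺ (All.map⁺ (All.tabulate⁺ λ u →
                          annihilated (per-group u) i (⋃-false (bad ∘ per-group) i none u)))
        ; few-bad     = begin
            size (⋃ (bad ∘ per-group)) * p ^ h                   ≤⟨ *-monoˡ-≤ (p ^ h) (size-⋃ (bad ∘ per-group)) ⟩
            (∑[ u < length L ] size (bad (per-group u))) * p ^ h ≡⟨ *-distribʳ-sum {length L} (p ^ h) _ ⟩
            ∑[ u < length L ] (size (bad (per-group u)) * p ^ h) ≤⟨ ∑-mono-≤ (few-bad ∘ per-group) ⟩
            ∑[ u < length L ] (m u * (k * q ^ h))                ≡⟨ *-distribʳ-sum {length L} (k * q ^ h) _ ⟨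
            (∑[ u < length L ] m u) * (k * q ^ h)                ≡⟨ cong (_* (k * q ^ h)) (∑-lookup Group.m L) ⟩
            sum (List.map Group.m L) * (k * q ^ h)               ∎
        }
        where
        open ≤-Reasoning
        m : Fin (length L) → ℕ
        m u = Group.m (lookup L u)
        per-group : ∀ u → GoodAssignment (Fin h → Fin (m u) → Fin p)
                                         (groupFactors h (λ j → bind σ (Group.g (lookup L u) j))) (m u)
        per-group u = group-assignment (m u) (λ j → bind σ (Group.g (lookup L u) j))

      assignment : ∀ {V : Set} (ℰ : Strat h V) (σ : V → Expr (Fin n)) →
                   GoodAssignment (Assign p ℰ) (allFactors ℰ σ) (count ℰ)
      assignment done        σ = unconstrained 0 tt refl
      assignment (level L S) σ = record
        { values      = values this , values rest
        ; bad         = λ i → bad this i ∨ bad rest i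
        ; annihilated = λ i none → ++⁺ (annihilated this i (∨-conicalˡ _ _ none))
                                       (annihilated rest i (∨-conicalʳ _ _ none))
        ; few-bad     = begin
            size (λ i → bad this i ∨ bad rest i) * p ^ h      ≤⟨ *-monoˡ-≤ (p ^ h) (size-∪ (bad this) (bad rest)) ⟩
            (size (bad this) + size (bad rest)) * p ^ h       ≡⟨ *-distribʳ-+ (p ^ h) (size (bad this)) _ ⟩
            size (bad this) * p ^ h + size (bad rest) * p ^ h ≤⟨ +-mono-≤ (few-bad this) (few-bad rest) ⟩
            sum (List.map Group.m L) * (k * q ^ h) + count S * (k * q ^ h)
              ≡⟨ *-distribʳ-+ (k * q ^ h) (sum (List.map Group.m L)) (count S) ⟨
            count (level L S) * (k * q ^ h)                   ∎
        }
        where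
        open ≤-Reasoning
        this = level-assignment L σ
        rest = assignment S [ σ , (λ v → con (+ toℕ (values this v))) ]

open import Defs
open import Data.Nat using (ℕ; _≤_; _*_; _^_; _!)
open import Data.Nat.Primality using (Prime)
open import Data.Fin using (Fin)
open import Data.Fin.Subset using (Subset; _∉_; ∣_∣)
open import Data.Vec using (Vec)
open import Data.List.Relation.Unary.All using (All)
open import Data.List.Relation.Unary.Any using (Any)
open import Data.Product using (Σ; _×_)
open import Relation.Binary.PropositionalEquality using (_≡_)

open FiniteSums using (size)
open ExponentialBound using (exp-bound)
open Assignments using (GoodAssignment; assignment)
open import Data.Bool using (Bool; true; false)
open import Data.Empty using (⊥-elim)
open import Data.Fin using (zero; suc)
open import Data.Nat using (zero; suc; NonZero)
open import Data.Nat.Properties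
open import Data.Nat.Primality using (¬prime[0])
open import Data.Product using (_,_)
import Data.Vec as Vec
open import Data.Vec.Properties using (lookup⇒[]=; lookup∘tabulate)
open import Relation.Binary.PropositionalEquality using (refl; trans; cong; sym; subst₂)
open import Algebra.Properties.CommutativeSemigroup *-commutativeSemigroup using (x∙yz≈y∙xz; x∙yz≈yx∙z)

∣tabulate∣≡size : ∀ {k} (f : Fin k → Bool) → ∣ Vec.tabulate f ∣ ≡ size f
∣tabulate∣≡size {zero}  f = refl
∣tabulate∣≡size {suc k} f with f zero
... | true  = cong suc (∣tabulate∣≡size (λ i → f (suc i)))
... | false = ∣tabulate∣≡size (λ i → f (suc i))

∉-tabulate : ∀ {k} (f : Fin k → Bool) {i} → i ∉ Vec.tabulate f → f i ≡ false
∉-tabulate f {i} i∉ with f i in fi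
... | true  = ⊥-elim (i∉ (lookup⇒[]= i (Vec.tabulate f) (trans (lookup∘tabulate f i) fi)))
... | false = refl

ratio-≤-trans : ∀ a b c d x y .{{_ : NonZero c}} → a * c ≤ b * d → d * x ≤ c * y → a * x ≤ b * y
ratio-≤-trans a b c d x y ac≤bd dx≤cy = *-cancelˡ-≤ c (begin
  c * (a * x) ≡⟨ x∙yz≈yx∙z c a x ⟩
  a * c * x   ≤⟨ *-monoˡ-≤ x ac≤bd ⟩
  b * d * x   ≡⟨ *-assoc b d x ⟩
  b * (d * x) ≤⟨ *-monoʳ-≤ b dx≤cy ⟩
  b * (c * y) ≡⟨ x∙yz≈y∙xz b c y ⟩
  c * (b * y) ∎)
  where open ≤-Reasoning

-- Only the primality of p is used: each map is given on all monomials, so neither the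
-- degree bounds nor the distinctness of the maps in Ω matter, and h = 0 or k = 0 is harmless.
lemma3p4 : (p d h n : ℕ) → Prime p → 1 ≤ h →
    (k : ℕ) → 1 ≤ k → (Ω : Fin k → LinMap p n) →
    (∀ i j → (∀ (m : Monomial n) → totalDeg m ≤ d → Ω i m ≡ Ω j m) → i ≡ j) →
    (ℰ : Strat h (Fin n)) →
    (∀ (b : Assign p ℰ) → All (All (DegLe p d)) (allFactors ℰ var b)) →
    Σ (Assign p ℰ) λ b → Σ (Subset k) λ B →
    (∀ i → i ∉ B → All (Any (Vanishes (Ω i))) (allFactors ℰ var b)) ×
    (∀ N → ∣ B ∣ * expNum h p N ≤ count ℰ * k * (p ^ N * N !))
lemma3p4 zero    _ _ _ p-prime _ _ _ _ _ _ _ = ⊥-elim (¬prime[0] p-prime)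
lemma3p4 (suc q) _ h n p-prime _ k _ Ω _ ℰ _ =
  values , B , (λ i i∉B → annihilated i (∉-tabulate bad i∉B)) ,
  λ N → ratio-≤-trans ∣ B ∣ (count ℰ * k) (suc q ^ h) (q ^ h) (expNum h (suc q) N) (suc q ^ N * N !)
          {{m^n≢0 (suc q) h}} few-bad′ (exp-bound q h N)
  where
  open GoodAssignment (assignment Ω h p-prime ℰ var)
  B = Vec.tabulate bad
  few-bad′ : ∣ B ∣ * suc q ^ h ≤ count ℰ * k * q ^ h
  few-bad′ = subst₂ _≤_ (cong (_* suc q ^ h) (sym (∣tabulate∣≡size bad))) (sym (*-assoc (count ℰ) k _)) few-bad
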